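{- Let $(G,\pi)$ be a parity game, $\tau$ a strategy for Odd, $T$ an $(n,d/2)$-universal tree, and $\mu:V\to\bar L(T)$ a node labeling such that $G_\tau$ has no loose arcs with respect to $\mu$. Then for every base node $v\in B(G_\tau)$ we have $\widehat{\mu}(v)\ge\mu^{\mathcal{G}^\uparrow_\tau}(v)$.
   Context: A parity game: finite directed graph $G=(V,E)$, every node with an outgoing arc, $V=V_0\sqcup V_1$ (Even's and Odd's nodes), priorities $\pi:V\to\{1,\dots,d\}$, $d$ even, $n=|V|$. A strategy for Odd is $\tau:V_1\to V$ with $v\tau(v)\in E$; $G_\tau=(V,E_\tau)$ with $E_\tau=\{vw\in E:v\in V_0\}\cup\{v\tau(v):v\in V_1\}$. A strategy for Even is $\sigma:V_0\to V$ with $v\sigma(v)\in E$; $G_\sigma$ keeps all arcs out of $V_1$ and only $v\sigma(v)$ out of $v\in V_0$. For a subgraph $H$, $\pi(H)$ is the maximum priority in $H$, $H$ is even if $\pi(H)$ is even, $\Pi(H)$ is the set of nodes of $H$ with priority $\pi(H)$, and $v$ dominates $H$ if $v\in\Pi(H)$. Ordered trees: prefix-closed sets of tuples over a linearly ordered set, viewed as rooted trees, ordered lexicographically; in a tree of height $h$ all leaves have depth $h$, a leaf is $\xi=(\xi_{2h-1},\dots,\xi_1)$ and its $p$-truncation $\xi|_p$ deletes the components with index $<p$. $L(T)$ = leaves, $\bar L(T)=L(T)\cup\{\top\}$ with $\top$ maximal and $\top|_p=\top$. An $(\ell,h)$-universal tree is an ordered tree of height $h$ into which every ordered tree of height $h$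 with at most $\ell$ leaves (all at depth $h$) embeds by an injective, edge-preserving, order-preserving, leaf-to-leaf map. A node labeling is $\mu:V\to\bar L(T)$, ordered pointwise. An arc $vw$ is non-violated w.r.t. $\mu$ if ($\pi(v)$ even and $\mu(v)|_{\pi(v)}\ge\mu(w)|_{\pi(v)}$) or ($\pi(v)$ odd and ($\mu(v)|_{\pi(v)}>\mu(w)|_{\pi(v)}$ or $\mu(v)=\mu(w)=\top$)); otherwise violated. It is tight if $\mu(v)$ is the smallest $\xi\in\bar L(T)$ such that $vw$ is non-violated after replacing $\mu(v)$ by $\xi$; loose if neither tight nor violated. $\mu$ is feasible in a subgraph $H$ if there is an Even strategy $\sigma$ with $v\sigma(v)\in E(H)$ for every $v\in V_0$ with an outgoing arc in $H$ such that all arcs of $H$ in $G_\sigma$ are non-violated. $\mu^{\mathcal{G}^\uparrow_\tau}$ is the pointwise least node labeling $\nu\ge\mu$ feasible in $G_\tau$ (it exists). A base node of $G_\tau$ is a node $v$ with $v\in\Pi(C)$ for some even cycle $C$ of $G_\tau$; $B(G_\tau)$ is the set of base nodes. The threshold label of $v\in B(G_\tau)$ is $\widehat{\mu}(v):=\min\{\tilde\mu(v):\tilde\mu:V\to\bar L(T),\ \tilde\mu(v)\ge\mu(v),\ \tilde\mu\text{ is feasible in some cycle dominated by }v\text{ in }G_\tau\}$. -}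

module Defs where

open import Data.Nat using (ℕ; zero; suc; _+_; _*_; _≤_; _<_; _⊔_; _≤?_)
open import Data.Nat.DivMod using (_%_; _/_)
open import Data.Fin using (Fin)
open import Data.List using (List; []; _∷_; length; _∷ʳ_; foldr; map)
open import Data.List.Membership.Propositional using (_∈_)
open import Data.List.Relation.Unary.All using (All)
open import Data.List.Relation.Unary.Unique.Propositional using (Unique)
open import Data.Product using (Σ; ∃; _×_; _,_; proj₁; proj₂)
open import Data.Sum using (_⊎_)
open import Data.Unit using (⊤)
open import Relation.Nullary using (¬_; yes; no)
open import Relation.Binary.PropositionalEquality using (_≡_)

IsEven : ℕ → Set
IsEven p = p % 2 ≡ 0

data Player : Set where
  even-player : Player
  odd-player  : Player

record ParityGame (n d : ℕ) : Set₁ where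
  field
    E      : Fin n → Fin n → Set
    owner  : Fin n → Player
    π      : Fin n → ℕ
    total  : ∀ v → ∃ λ w → E v w
    π-pos  : ∀ v → 1 ≤ π v
    π-bnd  : ∀ v → π v ≤ d
    d-even : IsEven d

module _ {n d : ℕ} (G : ParityGame n d) where
  open ParityGame G

  -- strategy for Odd (values on V₀ nodes are irrelevant)
  OddStrategy : Set
  OddStrategy = Σ (Fin n → Fin n) λ τ → ∀ v → owner v ≡ odd-player → E v (τ v)

  Eτ : OddStrategy → Fin n → Fin n → Set
  Eτ τ v w = (owner v ≡ even-player × E v w) ⊎ (owner v ≡ odd-player × w ≡ proj₁ τ v)

-- Ordered trees: prefix-closed sets of tuples over ℕ, lexicographic order.
-- A tuple (ξ_{2h-1}, …, ξ_1) is the list ξ_{2h-1} ∷ … ∷ ξ_1 ∷ [].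

Tree : Set₁
Tree = List ℕ → Set

data _<lex_ : List ℕ → List ℕ → Set where
  []<∷  : ∀ {y ys} → [] <lex (y ∷ ys)
  here  : ∀ {x y xs ys} → x < y → (x ∷ xs) <lex (y ∷ ys)
  there : ∀ {x xs ys} → xs <lex ys → (x ∷ xs) <lex (x ∷ ys)

Leaf : Tree → List ℕ → Set
Leaf T t = T t × (∀ x → ¬ T (t ∷ʳ x))

IsTreeOfHeight : ℕ → Tree → Set
IsTreeOfHeight h T =
  T [] ×
  (∀ t x → T (t ∷ʳ x) → T t) ×
  (∀ t → T t → length t ≤ h) ×
  (∀ t → Leaf T t → length t ≡ h)

AtMostLeaves : ℕ → Tree → Set
AtMostLeaves ℓ S = Σ (List (List ℕ)) λ ls → length ls ≤ ℓ × (∀ t → Leaf S t → t ∈ ls)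

Embedding : Tree → Tree → (List ℕ → List ℕ) → Set
Embedding S T f =
  (∀ t → S t → T (f t)) ×
  (∀ s t → S s → S t → f s ≡ f t → s ≡ t) ×
  (∀ t x → S (t ∷ʳ x) → ∃ λ y → f (t ∷ʳ x) ≡ f t ∷ʳ y) ×
  (∀ s t → S s → S t → s <lex t → f s <lex f t) ×
  (∀ t → Leaf S t → Leaf T (f t))

Universal : ℕ → ℕ → Tree → Set₁
Universal ℓ h T =
  IsTreeOfHeight h T ×
  (∀ S → IsTreeOfHeight h S → AtMostLeaves ℓ S → ∃ λ f → Embedding S T f)

data Lbl : Set where
  leaf : List ℕ → Lbl
  top  : Lbl

InBar : Tree → Lbl → Set
InBar T (leaf t) = Leaf T t
InBar T top      = ⊤

data _<L_ : Lbl → Lbl → Set where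
  leaf<leaf : ∀ {s t} → s <lex t → leaf s <L leaf t
  leaf<top  : ∀ {s} → leaf s <L top

_≤L_ : Lbl → Lbl → Set
a ≤L b = a <L b ⊎ a ≡ b

-- p-truncation: delete components with index < p
-- (the head of a list x ∷ xs has index 2·|xs| + 1)
trunc : ℕ → List ℕ → List ℕ
trunc p [] = []
trunc p (x ∷ xs) with p ≤? (2 * length xs + 1)
... | yes _ = x ∷ trunc p xs
... | no  _ = trunc p xs

truncL : ℕ → Lbl → Lbl
truncL p (leaf t) = leaf (trunc p t)
truncL p top      = top

NonViolated : ℕ → Lbl → Lbl → Set
NonViolated p a b =
  (IsEven p × truncL p b ≤L truncL p a) ⊎
  (¬ IsEven p × (truncL p b <L truncL p a ⊎ (a ≡ top × b ≡ top)))

Violated : ℕ → Lbl → Lbl → Set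
Violated p a b = ¬ NonViolated p a b

Tight : Tree → ℕ → Lbl → Lbl → Set
Tight T p a b = NonViolated p a b × (∀ ξ → InBar T ξ → NonViolated p ξ b → a ≤L ξ)

Loose : Tree → ℕ → Lbl → Lbl → Set
Loose T p a b = ¬ Tight T p a b × ¬ Violated p a b

Labeling : ℕ → Set
Labeling n = Fin n → Lbl

ValidLabeling : ∀ {n} → Tree → Labeling n → Set
ValidLabeling T μ = ∀ v → InBar T (μ v)

_≤ₚ_ : ∀ {n} → Labeling n → Labeling n → Set
μ ≤ₚ ν = ∀ v → μ v ≤L ν v

module _ {n d : ℕ} (G : ParityGame n d) where
  open ParityGame G

  Feasible : (Fin n → Fin n → Set) → Labeling n → Set
  Feasible H μ = Σ (Fin n → Fin n) λ σ →
    (∀ v → owner v ≡ even-player → E v (σ v)) ×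
    (∀ v → owner v ≡ even-player → (∃ λ w → H v w) → H v (σ v)) ×
    (∀ v w → H v w → (owner v ≡ odd-player ⊎ w ≡ σ v) → NonViolated (π v) (μ v) (μ w))

  IsLeastFeasibleAbove : Tree → OddStrategy G → Labeling n → Labeling n → Set
  IsLeastFeasibleAbove T τ μ ν =
    ValidLabeling T ν × μ ≤ₚ ν × Feasible (Eτ G τ) ν ×
    (∀ ν′ → ValidLabeling T ν′ → μ ≤ₚ ν′ → Feasible (Eτ G τ) ν′ → ν ≤ₚ ν′)

  -- cycles: a nonempty list x ∷ xs of distinct nodes; arcs between consecutive
  -- nodes and from the last node back to x
  cycArcsFrom : Fin n → Fin n → List (Fin n) → List (Fin n × Fin n)
  cycArcsFrom first cur [] = (cur , first) ∷ []
  cycArcsFrom first cur (y ∷ ys) = (cur , y) ∷ cycArcsFrom first y ys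

  Cycle : Set
  Cycle = Fin n × List (Fin n)

  nodes : Cycle → List (Fin n)
  nodes (x , xs) = x ∷ xs

  CycArc : Cycle → Fin n → Fin n → Set
  CycArc (x , xs) v w = (v , w) ∈ cycArcsFrom x x xs

  IsCycleIn : (Fin n → Fin n → Set) → Cycle → Set
  IsCycleIn H C = Unique (nodes C) × (∀ v w → CycArc C v w → H v w)

  πC : Cycle → ℕ
  πC C = foldr _⊔_ 0 (map π (nodes C))

  Dominates : Fin n → Cycle → Set
  Dominates v C = v ∈ nodes C × π v ≡ πC C

  IsBaseNode : OddStrategy G → Fin n → Set
  IsBaseNode τ v = ∃ λ C → IsCycleIn (Eτ G τ) C × IsEven (πC C) × Dominates v C

  ThresholdCandidate : Tree → OddStrategy G → Labeling n → Fin n → Labeling n → Set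
  ThresholdCandidate T τ μ v μ̃ =
    ValidLabeling T μ̃ × μ v ≤L μ̃ v ×
    (∃ λ C → IsCycleIn (Eτ G τ) C × Dominates v C × Feasible (CycArc C) μ̃)

  IsThresholdLabel : Tree → OddStrategy G → Labeling n → Fin n → Lbl → Set
  IsThresholdLabel T τ μ v ξ =
    (∃ λ μ̃ → ThresholdCandidate T τ μ v μ̃ × μ̃ v ≡ ξ) ×
    (∀ μ̃ → ThresholdCandidate T τ μ v μ̃ → ξ ≤L μ̃ v)

  NoLooseArcs : Tree → OddStrategy G → Labeling n → Set
  NoLooseArcs T τ μ = ∀ v w → Eτ G τ v w → ¬ Loose T (π v) (μ v) (μ w)

-- Let μ̃ attain μ̂(v): it is feasible on a cycle C of G_τ through v, with μ(v) ≤ μ̃(v).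
-- Walking C backwards gives μ ≤ μ̃ on all of C: if uw is an arc of C with μ(w) ≤ μ̃(w) but
-- μ̃(u) < μ(u), then uw is non-violated already at the value μ̃(u) < μ(u), so under μ it is
-- neither violated nor tight, i.e. loose. Extending μ̃|C by ⊤ off C gives a labeling ≥ μ that
-- is feasible in G_τ (every arc out of a ⊤-node is non-violated), so the least such labeling
-- μ^{G↑τ} lies below it, in particular at v.
module Submission where

open import Defs
open import Data.Nat using (ℕ; suc; _+_; _*_; _≤_; _≤?_; _≟_)
open import Data.Nat.Properties
  using (suc-injective; <-trans; <-irrefl; <-cmp; ≤-trans; n≤1+n; +-monoˡ-≤; *-monoʳ-≤)
open import Data.Nat.DivMod using (_/_; _%_)
open import Data.Fin using (Fin)
open import Data.Fin.Properties using () renaming (_≟_ to _≟ᶠ_)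
open import Data.List using (List; []; _∷_; length)
open import Data.List.Membership.Propositional using (_∈_)
import Data.List.Membership.DecPropositional as DecMembership
open import Data.List.Relation.Unary.Any using (here; there)
open import Data.List.Relation.Unary.All as All using (All; _∷_)
open import Data.List.Relation.Unary.AllPairs using (_∷_)
open import Data.List.Relation.Unary.Unique.Propositional using (Unique)
open import Data.Product as Product using (∃; _,_; proj₁)
open import Data.Sum as Sum using (_⊎_; inj₁; inj₂)
open import Data.Unit using (⊤; tt)
open import Function using (_∘_)
open import Relation.Nullary using (Dec; ¬_; yes; no; contradiction)
open import Relation.Binary using (tri<; tri≈; tri>)
open import Relation.Binary.PropositionalEquality using (_≡_; refl; sym; trans; cong; subst)

trunc-keep : ∀ {p} x xs → p ≤ 2 * length xs + 1 → trunc p (x ∷ xs) ≡ x ∷ trunc p xs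
trunc-keep {p} x xs keep with p ≤? 2 * length xs + 1
... | yes _    = refl
... | no  drop = contradiction keep drop

trunc-drop : ∀ {p} x xs → ¬ p ≤ 2 * length xs + 1 → trunc p (x ∷ xs) ≡ []
trunc-drop {p} x xs drop with p ≤? 2 * length xs + 1
trunc-drop x xs        drop | yes keep = contradiction keep drop
trunc-drop x []        drop | no _     = refl
trunc-drop x (y ∷ ys) drop | no _     = trunc-drop y ys (drop ∘ index-mono)
  where
  index-mono : ∀ {p} → p ≤ 2 * length ys + 1 → p ≤ 2 * suc (length ys) + 1
  index-mono p≤ = ≤-trans p≤ (+-monoˡ-≤ 1 (*-monoʳ-≤ 2 (n≤1+n (length ys))))

_≤lex_ : List ℕ → List ℕ → Set
s ≤lex t = s <lex t ⊎ s ≡ t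

trunc-cons-mono : ∀ p {x y xs ys} → length xs ≡ length ys →
                  (x ∷ trunc p xs) ≤lex (y ∷ trunc p ys) → trunc p (x ∷ xs) ≤lex trunc p (y ∷ ys)
trunc-cons-mono p {x} {y} {xs} {ys} |xs|≡|ys| cons≤ = by-index (p ≤? 2 * length xs + 1)
  where
  by-index : Dec (p ≤ 2 * length xs + 1) → trunc p (x ∷ xs) ≤lex trunc p (y ∷ ys)
  by-index (yes keep)
    rewrite trunc-keep x xs keep
          | trunc-keep y ys (subst (λ k → p ≤ 2 * k + 1) |xs|≡|ys| keep) = cons≤
  by-index (no drop)
    rewrite trunc-drop x xs drop
          | trunc-drop y ys (drop ∘ subst (λ k → p ≤ 2 * k + 1) (sym |xs|≡|ys|)) = inj₂ refl

trunc-mono : ∀ p {s t} → length s ≡ length t → s <lex t → trunc p s ≤lex trunc p t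
trunc-mono p ()      []<∷
trunc-mono p |s|≡|t| (here x<y) = trunc-cons-mono p (suc-injective |s|≡|t|) (inj₁ (here x<y))
trunc-mono p {x ∷ _} |s|≡|t| (there r) =
  trunc-cons-mono p (suc-injective |s|≡|t|)
    (Sum.map there (cong (x ∷_)) (trunc-mono p (suc-injective |s|≡|t|) r))

<lex-trans : ∀ {s t u} → s <lex t → t <lex u → s <lex u
<lex-trans []<∷      (here _)  = []<∷
<lex-trans []<∷      (there _) = []<∷
<lex-trans (here p)  (here q)  = here (<-trans p q)
<lex-trans (here p)  (there _) = here p
<lex-trans (there _) (here q)  = here q
<lex-trans (there p) (there q) = there (<lex-trans p q)

<lex-irrefl : ∀ {s} → ¬ s <lex s
<lex-irrefl (here p)  = <-irrefl refl p
<lex-irrefl (there p) = <lex-irrefl p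

<lex-cmp : ∀ s t → s <lex t ⊎ s ≡ t ⊎ t <lex s
<lex-cmp []       []       = inj₂ (inj₁ refl)
<lex-cmp []       (_ ∷ _)  = inj₁ []<∷
<lex-cmp (_ ∷ _)  []       = inj₂ (inj₂ []<∷)
<lex-cmp (x ∷ xs) (y ∷ ys) with <-cmp x y
... | tri< x<y _ _ = inj₁ (here x<y)
... | tri> _ _ y<x = inj₂ (inj₂ (here y<x))
... | tri≈ _ refl _ = Sum.map there (Sum.map (cong (x ∷_)) there) (<lex-cmp xs ys)

<L-trans : ∀ {a b c} → a <L b → b <L c → a <L c
<L-trans (leaf<leaf p) (leaf<leaf q) = leaf<leaf (<lex-trans p q)
<L-trans (leaf<leaf _) leaf<top      = leaf<top

<L-irrefl : ∀ {a} → ¬ a <L a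
<L-irrefl (leaf<leaf p) = <lex-irrefl p

≤L-trans : ∀ {a b c} → a ≤L b → b ≤L c → a ≤L c
≤L-trans (inj₁ p)    (inj₁ q)    = inj₁ (<L-trans p q)
≤L-trans (inj₁ p)    (inj₂ refl) = inj₁ p
≤L-trans (inj₂ refl) q           = q

<-≤L-trans : ∀ {a b c} → a <L b → b ≤L c → a <L c
<-≤L-trans p (inj₁ q)    = <L-trans p q
<-≤L-trans p (inj₂ refl) = p

≤-<L-trans : ∀ {a b c} → a ≤L b → b <L c → a <L c
≤-<L-trans (inj₁ p)    q = <L-trans p q
≤-<L-trans (inj₂ refl) q = q

≤L-top : ∀ a → a ≤L top
≤L-top (leaf _) = inj₁ leaf<top
≤L-top top      = inj₂ refl

≤L⊎>L : ∀ a b → a ≤L b ⊎ b <L a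
≤L⊎>L (leaf s) (leaf t) with <lex-cmp s t
... | inj₁ s<t        = inj₁ (inj₁ (leaf<leaf s<t))
... | inj₂ (inj₁ refl) = inj₁ (inj₂ refl)
... | inj₂ (inj₂ t<s) = inj₂ (leaf<leaf t<s)
≤L⊎>L (leaf _) top      = inj₁ (inj₁ leaf<top)
≤L⊎>L top      (leaf _) = inj₂ leaf<top
≤L⊎>L top      top      = inj₁ (inj₂ refl)

-- Truncation counts indices from the end of a tuple, so it is monotone only between labels of
-- equal depth: (0, 9) <lex (1) but trunc 3 maps them to (0) and ().
HasDepth : ℕ → Lbl → Set
HasDepth h (leaf t) = length t ≡ h
HasDepth h top      = ⊤

InBar⇒HasDepth : ∀ {h T} → IsTreeOfHeight h T → ∀ a → InBar T a → HasDepth h a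
InBar⇒HasDepth (_ , _ , _ , leaf-depth) (leaf t) t-leaf = leaf-depth t t-leaf
InBar⇒HasDepth _                        top      _    = tt

truncL-mono : ∀ p {h a b} → HasDepth h a → HasDepth h b → a ≤L b → truncL p a ≤L truncL p b
truncL-mono p _      _      (inj₂ refl)             = inj₂ refl
truncL-mono p |s|≡h |t|≡h (inj₁ (leaf<leaf s<t)) =
  Sum.map leaf<leaf (cong leaf) (trunc-mono p (trans |s|≡h (sym |t|≡h)) s<t)
truncL-mono p _      _      (inj₁ leaf<top)         = inj₁ leaf<top

NonViolated-monoˡ : ∀ {p h a a′ b} → HasDepth h a → HasDepth h a′ → a ≤L a′ →
                    NonViolated p a b → NonViolated p a′ b
NonViolated-monoˡ da da′ a≤a′ (inj₁ (even , b≤a)) =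
  inj₁ (even , ≤L-trans b≤a (truncL-mono _ da da′ a≤a′))
NonViolated-monoˡ da da′ a≤a′ (inj₂ (odd , inj₁ b<a)) =
  inj₂ (odd , inj₁ (<-≤L-trans b<a (truncL-mono _ da da′ a≤a′)))
NonViolated-monoˡ _ _ (inj₂ refl) (inj₂ (odd , inj₂ tops))          = inj₂ (odd , inj₂ tops)
NonViolated-monoˡ _ _ (inj₁ ())   (inj₂ (_ , inj₂ (refl , refl)))

NonViolated-antimonoʳ : ∀ {p h a b b′} → HasDepth h b → HasDepth h b′ → b ≤L b′ →
                        NonViolated p a b′ → NonViolated p a b
NonViolated-antimonoʳ db db′ b≤b′ (inj₁ (even , b′≤a)) =
  inj₁ (even , ≤L-trans (truncL-mono _ db db′ b≤b′) b′≤a)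
NonViolated-antimonoʳ db db′ b≤b′ (inj₂ (odd , inj₁ b′<a)) =
  inj₂ (odd , inj₁ (≤-<L-trans (truncL-mono _ db db′ b≤b′) b′<a))
NonViolated-antimonoʳ {b = leaf _} _ _ _ (inj₂ (odd , inj₂ (refl , refl))) = inj₂ (odd , inj₁ leaf<top)
NonViolated-antimonoʳ {b = top}    _ _ _ (inj₂ (odd , inj₂ (refl , refl))) = inj₂ (odd , inj₂ (refl , refl))

top-nonViolated : ∀ p b → NonViolated p top b
top-nonViolated p b with p % 2 ≟ 0
top-nonViolated p (leaf _) | yes even = inj₁ (even , inj₁ leaf<top)
top-nonViolated p top      | yes even = inj₁ (even , inj₂ refl)
top-nonViolated p (leaf _) | no odd   = inj₂ (odd , inj₁ leaf<top)
top-nonViolated p top      | no odd   = inj₂ (odd , inj₂ (refl , refl))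

nonLoose⇒≤L : ∀ {T h p a b ã c} → HasDepth h a → HasDepth h b → HasDepth h ã → HasDepth h c →
              InBar T ã → ¬ Loose T p a b → b ≤L c → NonViolated p ã c → a ≤L ã
nonLoose⇒≤L {ã = ã} da db dã dc ã∈T not-loose b≤c ãc with ≤L⊎>L _ ã
... | inj₁ a≤ã = a≤ã
... | inj₂ ã<a = contradiction (not-tight , not-violated) not-loose
  where
  ãb : NonViolated _ ã _
  ãb = NonViolated-antimonoʳ db dc b≤c ãc
  not-violated : ¬ Violated _ _ _
  not-violated violated = violated (NonViolated-monoˡ dã da (inj₁ ã<a) ãb)
  not-tight : ¬ Tight _ _ _ _
  not-tight (_ , least) = <L-irrefl (<-≤L-trans ã<a (least ã ã∈T ãb))

module _ {n : ℕ} where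
  open DecMembership (_≟ᶠ_ {n}) using (_∈?_)

  restrict : List (Fin n) → Labeling n → Labeling n
  restrict L μ u with u ∈? L
  ... | yes _ = μ u
  ... | no  _ = top

  restrict-elim : ∀ (P : Lbl → Set) {L μ u} → P top → (u ∈ L → P (μ u)) → P (restrict L μ u)
  restrict-elim P {L} {u = u} P-top P-μ with u ∈? L
  ... | yes u∈ = P-μ u∈
  ... | no  _  = P-top

  restrict-∈ : ∀ {L μ u} → u ∈ L → restrict L μ u ≡ μ u
  restrict-∈ {L} {u = u} u∈ with u ∈? L
  ... | yes _  = refl
  ... | no  u∉ = contradiction u∈ u∉

  restrict-valid : ∀ {T} L {μ} → ValidLabeling T μ → ValidLabeling T (restrict L μ)
  restrict-valid {T} L {μ} μ-valid u = restrict-elim (InBar T) {L} {μ} tt (λ _ → μ-valid u)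

  restrict-above : ∀ {L μ μ̃} → All (λ u → μ u ≤L μ̃ u) L → μ ≤ₚ restrict L μ̃
  restrict-above {μ = μ} μ≤μ̃ u = restrict-elim (μ u ≤L_) (≤L-top (μ u)) (All.lookup μ≤μ̃)

module _ {n d : ℕ} (G : ParityGame n d) where
  open ParityGame G

  private
    Arc : Fin n → Fin n → List (Fin n) → Fin n → Fin n → Set
    Arc first cur ys a b = (a , b) ∈ cycArcsFrom G first cur ys

  arc-source∈ : ∀ {first cur ys a b} → Arc first cur ys a b → a ∈ cur ∷ ys
  arc-source∈ {ys = []}     (here refl) = here refl
  arc-source∈ {ys = _ ∷ _} (here refl) = here refl
  arc-source∈ {ys = _ ∷ _} (there ab)  = there (arc-source∈ ab)

  arc-target∈ : ∀ {first cur ys a b} → Arc first cur ys a b → b ≡ first ⊎ b ∈ ys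
  arc-target∈ {ys = []}     (here refl) = inj₁ refl
  arc-target∈ {ys = _ ∷ _} (here refl) = inj₂ (here refl)
  arc-target∈ {ys = _ ∷ _} (there ab)  = Sum.map₂ there (arc-target∈ ab)

  arc-out : ∀ {first cur ys a} → a ∈ cur ∷ ys → ∃ (Arc first cur ys a)
  arc-out {first} {ys = []}     (here refl) = first , here refl
  arc-out {ys = y ∷ _}         (here refl) = y , here refl
  arc-out {ys = _ ∷ _}         (there a∈)  = Product.map₂ there (arc-out a∈)

  arc-out-unique : ∀ {first cur ys a b b′} → Unique (cur ∷ ys) →
                   Arc first cur ys a b → Arc first cur ys a b′ → b ≡ b′
  arc-out-unique {ys = []}     _            (here refl) (here refl) = refl
  arc-out-unique {ys = _ ∷ _} _            (here refl) (here refl) = refl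
  arc-out-unique {ys = _ ∷ _} (cur∉ ∷ _)  (here refl) (there ab′) =
    contradiction refl (All.lookup cur∉ (arc-source∈ ab′))
  arc-out-unique {ys = _ ∷ _} (cur∉ ∷ _)  (there ab)  (here refl) =
    contradiction refl (All.lookup cur∉ (arc-source∈ ab))
  arc-out-unique {ys = _ ∷ _} (_ ∷ unique) (there ab)  (there ab′) = arc-out-unique unique ab ab′

  module _ (P : Fin n → Set) where

    BackwardClosed : Fin n → Fin n → List (Fin n) → Set
    BackwardClosed first cur ys = ∀ a b → Arc first cur ys a b → P b → P a

    backward-to-start : ∀ {first cur ys u} → BackwardClosed first cur ys →
                        u ∈ cur ∷ ys → P u → P cur
    backward-to-start {ys = []}     _      (here refl) Pu = Pu
    backward-to-start {ys = _ ∷ _} _      (here refl) Pu = Pu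
    backward-to-start {cur = cur} {ys = y ∷ _} closed (there u∈) Pu =
      closed cur y (here refl) (backward-to-start (λ a b → closed a b ∘ there) u∈ Pu)

    backward-from-end : ∀ {first cur ys} → BackwardClosed first cur ys → P first → All P (cur ∷ ys)
    backward-from-end {first} {cur} {[]}     closed Pfirst = closed cur first (here refl) Pfirst ∷ All.[]
    backward-from-end {first} {cur} {y ∷ ys} closed Pfirst =
      closed cur y (here refl) (All.head P-rest) ∷ P-rest
      where
      P-rest : All P (y ∷ ys)
      P-rest = backward-from-end (λ a b → closed a b ∘ there) Pfirst

    cycle-backward-closed : ∀ C → (∀ a b → CycArc G C a b → P b → P a) →
                            ∀ {u} → u ∈ nodes G C → P u → All P (nodes G C)
    cycle-backward-closed (x , xs) closed u∈ Pu =
      backward-from-end closed (backward-to-start closed u∈ Pu)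

  CycArc-out : ∀ C {a} → a ∈ nodes G C → ∃ (CycArc G C a)
  CycArc-out (x , xs) = arc-out

  CycArc-target∈ : ∀ C {a b} → CycArc G C a b → b ∈ nodes G C
  CycArc-target∈ (x , xs) ab = Sum.[ (λ { refl → here refl }) , there ] (arc-target∈ ab)

  cycle-feasible⇒nonViolated : ∀ C {μ} → Unique (nodes G C) → Feasible G (CycArc G C) μ →
                               ∀ a b → CycArc G C a b → NonViolated (π a) (μ a) (μ b)
  cycle-feasible⇒nonViolated (x , xs) unique (σ , _ , σ-on-C , σ-nonViolated) a b ab
    with owner a in eq
  ... | odd-player  = σ-nonViolated a b ab (inj₁ eq)
  ... | even-player = σ-nonViolated a b ab (inj₂ (arc-out-unique unique ab (σ-on-C a eq (b , ab))))

  module _ (τ : OddStrategy G) where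

    odd-arc-follows-τ : ∀ {u w} → owner u ≡ odd-player → Eτ G τ u w → w ≡ proj₁ τ u
    odd-arc-follows-τ odd (inj₁ (even , _)) = contradiction (trans (sym even) odd) λ ()
    odd-arc-follows-τ _   (inj₂ (_ , w≡τu)) = w≡τu

    strategy-arc-on-cycle : ∀ C {σ : Fin n → Fin n} → IsCycleIn G (Eτ G τ) C →
      (∀ v → owner v ≡ even-player → ∃ (CycArc G C v) → CycArc G C v (σ v)) →
      ∀ {u w} → u ∈ nodes G C → Eτ G τ u w → owner u ≡ odd-player ⊎ w ≡ σ u → CycArc G C u w
    strategy-arc-on-cycle C {σ} (_ , C⊆Gτ) σ-on-C {u} {w} u∈ uw odd⊎σ =
      by-owner (owner u) refl odd⊎σ
      where
      by-owner : ∀ p → owner u ≡ p → p ≡ odd-player ⊎ w ≡ σ u → CycArc G C u w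
      by-owner even-player even (inj₂ refl) = σ-on-C u even (CycArc-out C u∈)
      by-owner odd-player  odd  _           with CycArc-out C u∈
      ... | b , ub = subst (CycArc G C u) (trans (odd-arc-follows-τ odd (C⊆Gτ u b ub))
                                                 (sym (odd-arc-follows-τ odd uw))) ub

    restrict-feasible : ∀ C {μ} → IsCycleIn G (Eτ G τ) C → Feasible G (CycArc G C) μ →
                        Feasible G (Eτ G τ) (restrict (nodes G C) μ)
    restrict-feasible C {μ} C-in@(unique , _) μ-feasible@(σ , σ-arc , σ-on-C , _) =
      σ , σ-arc , (λ u even _ → inj₁ (even , σ-arc u even)) , nonViolated
      where
      nonViolated : ∀ u w → Eτ G τ u w → owner u ≡ odd-player ⊎ w ≡ σ u →
                    NonViolated (π u) (restrict (nodes G C) μ u) (restrict (nodes G C) μ w)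
      nonViolated u w uw odd⊎σ =
        restrict-elim (λ a → NonViolated (π u) a (restrict (nodes G C) μ w))
                      (top-nonViolated _ _) λ u∈ →
          let cycle-arc = strategy-arc-on-cycle C C-in σ-on-C u∈ uw odd⊎σ in
          subst (NonViolated (π u) (μ u)) (sym (restrict-∈ (CycArc-target∈ C cycle-arc)))
                (cycle-feasible⇒nonViolated C unique μ-feasible u w cycle-arc)

    feasible-above-on-cycle : ∀ {T h} C {μ μ̃ v} → IsTreeOfHeight h T →
      ValidLabeling T μ → ValidLabeling T μ̃ → NoLooseArcs G T τ μ →
      IsCycleIn G (Eτ G τ) C → Feasible G (CycArc G C) μ̃ →
      v ∈ nodes G C → μ v ≤L μ̃ v → All (λ u → μ u ≤L μ̃ u) (nodes G C)
    feasible-above-on-cycle {T} {h} C {μ} {μ̃} height μ-valid μ̃-valid no-loose (unique , C⊆Gτ) μ̃-feasible =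
      cycle-backward-closed (λ u → μ u ≤L μ̃ u) C λ a b ab μb≤μ̃b →
        nonLoose⇒≤L (depth μ μ-valid a) (depth μ μ-valid b) (depth μ̃ μ̃-valid a) (depth μ̃ μ̃-valid b)
                    (μ̃-valid a) (no-loose a b (C⊆Gτ a b ab)) μb≤μ̃b
                    (cycle-feasible⇒nonViolated C unique μ̃-feasible a b ab)
      where
      depth : ∀ κ → ValidLabeling T κ → ∀ u → HasDepth h (κ u)
      depth κ valid u = InBar⇒HasDepth height (κ u) (valid u)

lemma4p2 : (n d : ℕ) (G : ParityGame n d) (τ : OddStrategy G) (T : Tree)
    → Universal n (d / 2) T
    → (μ : Labeling n) → ValidLabeling T μ
    → NoLooseArcs G T τ μ
    → (ν : Labeling n) → IsLeastFeasibleAbove G T τ μ ν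
    → (v : Fin n) → IsBaseNode G τ v
    → (ξ : Lbl) → IsThresholdLabel G T τ μ v ξ
    → ν v ≤L ξ
-- Universality of T enters only through its height, and of v only its lying on the cycle of the
-- candidate attaining μ̂(v).
lemma4p2 n d G τ T (height , _) μ μ-valid no-loose ν (_ , _ , _ , ν-least) v _ ξ
  ((μ̃ , (μ̃-valid , μv≤μ̃v , (C , C-in , (v∈C , _) , μ̃-feasible)) , refl) , _) =
  subst (ν v ≤L_) (restrict-∈ {μ = μ̃} v∈C) (ν-least ν′ ν′-valid μ≤ν′ ν′-feasible v)
  where
  ν′ : Labeling n
  ν′ = restrict (nodes G C) μ̃

  ν′-valid : ValidLabeling T ν′
  ν′-valid = restrict-valid (nodes G C) μ̃-valid

  μ≤ν′ : μ ≤ₚ ν′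
  μ≤ν′ = restrict-above (feasible-above-on-cycle G τ C height μ-valid μ̃-valid no-loose
                                                 C-in μ̃-feasible v∈C μv≤μ̃v)

  ν′-feasible : Feasible G (Eτ G τ) ν′
  ν′-feasible = restrict-feasible G τ C C-in μ̃-feasible
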